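{- Let $m\neq0$ and $r$ be real and let $\alpha_0,\alpha_1,\dots$ be real numbers. Then for all $0\le i\le n$, \[ W_{m,r;\overline{\alpha}}(n,i)=\sum_{k=i}^{n}m^{k-i}\,W_{m,r}(n,k)\,s(k,i;\overline{\alpha}). \]
   Context: Let $(x)_k=x(x-1)\cdots(x-k+1)$, $(x)_0=1$, and for a real sequence $\overline{\alpha}=(\alpha_0,\alpha_1,\dots)$ let $(x;\overline{\alpha})_n=\prod_{i=0}^{n-1}(x-\alpha_i)$, $(x;\overline{\alpha})_0=1$. The $r$-Whitney numbers of the second kind $W_{m,r}(n,k)$ are defined by $(mx+r)^n=\sum_{k=0}^{n}W_{m,r}(n,k)m^k(x)_k$. The multiparameter Stirling numbers of the first kind $s(n,k;\overline{\alpha})$ are defined by $(x)_n=\sum_{k=0}^{n}s(n,k;\overline{\alpha})(x;\overline{\alpha})_k$. The generalized $r$-Whitney numbers of the second kind $W_{m,r;\overline{\alpha}}(n,k)$ are defined by $(mx+r)^n=\sum_{k=0}^{n}W_{m,r;\overline{\alpha}}(n,k)m^k(x;\overline{\alpha})_k$. All identities are polynomial identities in $x$. -}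

module Defs where

open import Level using (Level)
open import Data.Nat as ℕ using (ℕ; zero; suc; _∸_)
open import Algebra.Bundles using (CommutativeRing)

-- All notions are defined over an arbitrary commutative ring R
-- (the paper works over the reals, which are an instance).
module RingDefs {c ℓ : Level} (R : CommutativeRing c ℓ) where
  open CommutativeRing R

  ofℕ : ℕ → Carrier
  ofℕ zero    = 0#
  ofℕ (suc n) = 1# + ofℕ n

  pow : Carrier → ℕ → Carrier
  pow x zero    = 1#
  pow x (suc n) = pow x n * x

  falling : Carrier → ℕ → Carrier
  falling x zero    = 1#
  falling x (suc k) = falling x k * (x - ofℕ k)

  gfalling : (ℕ → Carrier) → Carrier → ℕ → Carrier
  gfalling α x zero    = 1#
  gfalling α x (suc k) = gfalling α x k * (x - α k)

  sumTo : ℕ → (ℕ → Carrier) → Carrier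
  sumTo zero    f = f 0
  sumTo (suc n) f = sumTo n f + f (suc n)

  sumFromTo : ℕ → ℕ → (ℕ → Carrier) → Carrier
  sumFromTo i n f = sumTo (n ∸ i) (λ j → f (i ℕ.+ j))

  IsRWhitney2 : Carrier → Carrier → (ℕ → ℕ → Carrier) → Set (c Level.⊔ ℓ)
  IsRWhitney2 m r W = ∀ (n : ℕ) (x : Carrier) →
    pow (m * x + r) n ≈ sumTo n (λ k → W n k * pow m k * falling x k)

  IsMultiStirling1 : (ℕ → Carrier) → (ℕ → ℕ → Carrier) → Set (c Level.⊔ ℓ)
  IsMultiStirling1 α s = ∀ (n : ℕ) (x : Carrier) →
    falling x n ≈ sumTo n (λ k → s n k * gfalling α x k)

  IsGenRWhitney2 : Carrier → Carrier → (ℕ → Carrier) → (ℕ → ℕ → Carrier) → Set (c Level.⊔ ℓ)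
  IsGenRWhitney2 m r α Wα = ∀ (n : ℕ) (x : Carrier) →
    pow (m * x + r) n ≈ sumTo n (λ k → Wα n k * pow m k * gfalling α x k)

module Submission where

-- Both sides are the coefficient of (x; α)_i in the Newton expansion of (m x + r)^n:
-- by definition it is Wα(n,i) m^i, while substituting the Stirling expansion of (x)_k
-- into the r-Whitney expansion and exchanging the triangular double sum gives
-- Σ_{k=i}^{n} W(n,k) m^k s(k,i;α).  Newton coefficients are unique over an integral
-- domain of characteristic zero: evaluating at α_0 recovers c_0, and the rest is
-- (x − α_0) times a Newton sum of lower degree, which is determined everywhere since
-- a polynomial function of degree ≤ n is determined by its values at n + 1 distinct
-- points.  Cancelling m^i ≠ 0 finishes the proof.

open import Level using (Level; _⊔_)
open import Function using (_∘_)
open import Data.Nat as ℕ using (ℕ; zero; suc; _≤_; _<_; _∸_; z≤n; s≤s)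
import Data.Nat.Properties as ℕ
open import Data.Product using (∃-syntax; _×_; _,_)
open import Data.Sum using (_⊎_; inj₁; inj₂)
open import Relation.Nullary using (¬_; contradiction)
open import Algebra.Bundles using (CommutativeRing)
import Algebra.Properties.CommutativeSemigroup
open import Defs

module NewtonExpansions {c ℓ : Level} (R : CommutativeRing c ℓ) where

  open CommutativeRing R
  open RingDefs R
  open import Algebra.Properties.Ring ring using (x[y-z]≈xy-xz)
  open import Algebra.Properties.AbelianGroup +-abelianGroup
    using (∙-cancelˡ; x∙y⁻¹≈ε⇒x≈y; x≈y⇒x∙y⁻¹≈ε)
  module +-Props = Algebra.Properties.CommutativeSemigroup +-commutativeSemigroup
  module *-Props = Algebra.Properties.CommutativeSemigroup *-commutativeSemigroup
  open import Relation.Binary.Reasoning.Setoid setoid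

  sumTo-cong : ∀ n {f g : ℕ → Carrier} → (∀ k → k ≤ n → f k ≈ g k) → sumTo n f ≈ sumTo n g
  sumTo-cong zero    f≈g = f≈g 0 z≤n
  sumTo-cong (suc n) f≈g =
    +-cong (sumTo-cong n (λ k k≤n → f≈g k (ℕ.m≤n⇒m≤1+n k≤n))) (f≈g (suc n) ℕ.≤-refl)

  sumTo-+ : ∀ n (f g : ℕ → Carrier) → sumTo n (λ k → f k + g k) ≈ sumTo n f + sumTo n g
  sumTo-+ zero    f g = refl
  sumTo-+ (suc n) f g = trans (+-congʳ (sumTo-+ n f g)) (+-Props.interchange _ _ _ _)

  sumTo-*ˡ : ∀ n a (f : ℕ → Carrier) → sumTo n (λ k → a * f k) ≈ a * sumTo n f
  sumTo-*ˡ zero    a f = refl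
  sumTo-*ˡ (suc n) a f = trans (+-congʳ (sumTo-*ˡ n a f)) (sym (distribˡ _ _ _))

  sumTo-*ʳ : ∀ n a (f : ℕ → Carrier) → sumTo n (λ k → f k * a) ≈ sumTo n f * a
  sumTo-*ʳ zero    a f = refl
  sumTo-*ʳ (suc n) a f = trans (+-congʳ (sumTo-*ʳ n a f)) (sym (distribʳ _ _ _))

  sumTo-unfoldˡ : ∀ n (f : ℕ → Carrier) → sumTo (suc n) f ≈ f 0 + sumTo n (f ∘ suc)
  sumTo-unfoldˡ zero    f = refl
  sumTo-unfoldˡ (suc n) f = trans (+-congʳ (sumTo-unfoldˡ n f)) (+-assoc _ _ _)

  sumFromTo-cong : ∀ i n {f g : ℕ → Carrier} → (∀ k → f k ≈ g k) → sumFromTo i n f ≈ sumFromTo i n g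
  sumFromTo-cong i n f≈g = sumTo-cong (n ∸ i) (λ j _ → f≈g (i ℕ.+ j))

  sumFromTo-self : ∀ n (f : ℕ → Carrier) → sumFromTo n n f ≈ f n
  sumFromTo-self n f rewrite ℕ.n∸n≡0 n | ℕ.+-identityʳ n = refl

  sumFromTo-extend : ∀ i n (f : ℕ → Carrier) → i ≤ n →
    sumFromTo i (suc n) f ≈ sumFromTo i n f + f (suc n)
  sumFromTo-extend i n f i≤n
    rewrite ℕ.+-∸-assoc 1 i≤n | ℕ.+-suc i (n ∸ i) | ℕ.m+[n∸m]≡n i≤n = refl

  sumTo-triangle-swap : ∀ n (T : ℕ → ℕ → Carrier) →
    sumTo n (λ k → sumTo k (T k)) ≈ sumTo n (λ i → sumFromTo i n (λ k → T k i))
  sumTo-triangle-swap zero    T = refl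
  sumTo-triangle-swap (suc n) T = begin
    sumTo n (λ k → sumTo k (T k)) + (sumTo n (T (suc n)) + T (suc n) (suc n))
      ≈⟨ sym (+-assoc _ _ _) ⟩
    sumTo n (λ k → sumTo k (T k)) + sumTo n (T (suc n)) + T (suc n) (suc n)
      ≈⟨ +-cong (+-congʳ (sumTo-triangle-swap n T)) (sym (sumFromTo-self (suc n) (λ k → T k (suc n)))) ⟩
    sumTo n (λ i → sumFromTo i n (λ k → T k i)) + sumTo n (T (suc n))
      + sumFromTo (suc n) (suc n) (λ k → T k (suc n))
      ≈⟨ +-congʳ (sym (sumTo-+ n _ _)) ⟩
    sumTo n (λ i → sumFromTo i n (λ k → T k i) + T (suc n) i)
      + sumFromTo (suc n) (suc n) (λ k → T k (suc n))
      ≈⟨ +-congʳ (sumTo-cong n (λ i i≤n → sym (sumFromTo-extend i n (λ k → T k i) i≤n))) ⟩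
    sumTo (suc n) (λ i → sumFromTo i (suc n) (λ k → T k i)) ∎

  sumTo-change-of-basis : ∀ n (P Q a : ℕ → Carrier) (s : ℕ → ℕ → Carrier) →
    (∀ k → k ≤ n → P k ≈ sumTo k (λ i → s k i * Q i)) →
    sumTo n (λ k → a k * P k) ≈ sumTo n (λ i → sumFromTo i n (λ k → a k * s k i) * Q i)
  sumTo-change-of-basis n P Q a s P≈sQ = begin
    sumTo n (λ k → a k * P k)
      ≈⟨ sumTo-cong n (λ k k≤n → *-congˡ (P≈sQ k k≤n)) ⟩
    sumTo n (λ k → a k * sumTo k (λ i → s k i * Q i))
      ≈⟨ sumTo-cong n (λ k _ → sym (sumTo-*ˡ k (a k) _)) ⟩
    sumTo n (λ k → sumTo k (λ i → a k * (s k i * Q i)))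
      ≈⟨ sumTo-triangle-swap n _ ⟩
    sumTo n (λ i → sumFromTo i n (λ k → a k * (s k i * Q i)))
      ≈⟨ sumTo-cong n (λ i _ → sumTo-cong (n ∸ i) (λ j _ → sym (*-assoc _ _ _))) ⟩
    sumTo n (λ i → sumFromTo i n (λ k → a k * s k i * Q i))
      ≈⟨ sumTo-cong n (λ i _ → sumTo-*ʳ (n ∸ i) (Q i) _) ⟩
    sumTo n (λ i → sumFromTo i n (λ k → a k * s k i) * Q i) ∎

  pow-+ : ∀ y i j → pow y (i ℕ.+ j) ≈ pow y i * pow y j
  pow-+ y zero    j = sym (*-identityˡ _)
  pow-+ y (suc i) j = begin
    pow y (i ℕ.+ j) * y       ≈⟨ *-congʳ (pow-+ y i j) ⟩
    pow y i * pow y j * y     ≈⟨ *-Props.xy∙z≈xz∙y _ _ _ ⟩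
    pow y i * y * pow y j     ∎

  sumFromTo-pow-factor : ∀ i n y (f : ℕ → Carrier) →
    sumFromTo i n (λ k → pow y k * f k) ≈ pow y i * sumFromTo i n (λ k → pow y (k ∸ i) * f k)
  sumFromTo-pow-factor i n y f = trans (sumTo-cong (n ∸ i) factor) (sumTo-*ˡ (n ∸ i) _ _)
    where
    factor : ∀ j → j ≤ n ∸ i →
      pow y (i ℕ.+ j) * f (i ℕ.+ j) ≈ pow y i * (pow y (i ℕ.+ j ∸ i) * f (i ℕ.+ j))
    factor j _ rewrite ℕ.m+n∸m≡n i j =
      trans (*-congʳ (pow-+ y i j)) (*-assoc _ _ _)

  linear-shift : ∀ x a b u → (x - b) * u ≈ (x - a) * u + (a - b) * u
  linear-shift x a b u = trans (*-congʳ x-b≈[x-a]+[a-b]) (distribʳ u _ _)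
    where
    x-b≈[x-a]+[a-b] : x - b ≈ (x - a) + (a - b)
    x-b≈[x-a]+[a-b] = begin
      x - b                 ≈⟨ +-congʳ (sym (+-identityʳ x)) ⟩
      x + 0# - b            ≈⟨ +-congʳ (+-congˡ (sym (-‿inverseˡ a))) ⟩
      x + (- a + a) - b     ≈⟨ +-congʳ (sym (+-assoc _ _ _)) ⟩
      x - a + a - b         ≈⟨ +-assoc _ _ _ ⟩
      (x - a) + (a - b)     ∎

  x≈x+y*0 : ∀ x y → x ≈ x + y * 0#
  x≈x+y*0 x y = sym (trans (+-congˡ (zeroʳ y)) (+-identityʳ x))

  -- Degree ≤ n is defined through the factor theorem: at every point a,
  -- f x − f a factors as (x − a) times a function of degree ≤ n − 1.
  Poly≤ : ℕ → (Carrier → Carrier) → Set (c ⊔ ℓ)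
  Poly≤ zero    f = ∀ x y → f x ≈ f y
  Poly≤ (suc n) f = ∀ a → ∃[ q ] (Poly≤ n q × (∀ x → f x ≈ f a + (x - a) * q x))

  poly-cong : ∀ n {f g : Carrier → Carrier} → (∀ x → f x ≈ g x) → Poly≤ n f → Poly≤ n g
  poly-cong zero    f≈g pf x y = trans (sym (f≈g x)) (trans (pf x y) (f≈g y))
  poly-cong (suc n) f≈g pf a with pf a
  ... | q , pq , factor = q , pq , λ x → trans (sym (f≈g x)) (trans (factor x) (+-congʳ (f≈g a)))

  poly-const : ∀ n u → Poly≤ n (λ _ → u)
  poly-const zero    u x y = refl
  poly-const (suc n) u a   = (λ _ → 0#) , poly-const n 0# , λ x → x≈x+y*0 u (x - a)

  poly-raise : ∀ n {f : Carrier → Carrier} → Poly≤ n f → Poly≤ (suc n) f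
  poly-raise zero    pf a = (λ _ → 0#) , poly-const 0 0# , λ x → trans (pf x a) (x≈x+y*0 _ (x - a))
  poly-raise (suc n) pf a with pf a
  ... | q , pq , factor = q , poly-raise n pq , factor

  poly-+ : ∀ n {f g : Carrier → Carrier} → Poly≤ n f → Poly≤ n g → Poly≤ n (λ x → f x + g x)
  poly-+ zero    pf pg x y = +-cong (pf x y) (pg x y)
  poly-+ (suc n) pf pg a with pf a | pg a
  ... | q , pq , f-factor | q′ , pq′ , g-factor = (λ x → q x + q′ x) , poly-+ n pq pq′ , λ x →
    trans (+-cong (f-factor x) (g-factor x))
          (trans (+-Props.interchange _ _ _ _) (+-congˡ (sym (distribˡ (x - a) _ _))))

  poly-scale : ∀ n u {f : Carrier → Carrier} → Poly≤ n f → Poly≤ n (λ x → u * f x)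
  poly-scale zero    u pf x y = *-congˡ (pf x y)
  poly-scale (suc n) u pf a with pf a
  ... | q , pq , factor = (λ x → u * q x) , poly-scale n u pq , λ x →
    trans (*-congˡ (factor x))
          (trans (distribˡ u _ _) (+-congˡ (*-Props.x∙yz≈y∙xz u (x - a) (q x))))

  poly-*-linear : ∀ n b {f : Carrier → Carrier} → Poly≤ n f → Poly≤ (suc n) (λ x → (x - b) * f x)
  poly-*-linear zero b {f} pf a = f , pf , λ x → begin
    (x - b) * f x                   ≈⟨ linear-shift x a b (f x) ⟩
    (x - a) * f x + (a - b) * f x   ≈⟨ +-comm _ _ ⟩
    (a - b) * f x + (x - a) * f x   ≈⟨ +-congʳ (*-congˡ (pf x a)) ⟩
    (a - b) * f a + (x - a) * f x   ∎
  poly-*-linear (suc n) b {f} pf a with pf a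
  ... | q , pq , factor =
    (λ x → f x + (a - b) * q x) , poly-+ (suc n) pf (poly-raise n (poly-scale n (a - b) pq)) , λ x →
    begin
    (x - b) * f x
      ≈⟨ linear-shift x a b (f x) ⟩
    (x - a) * f x + (a - b) * f x
      ≈⟨ +-congˡ (trans (*-congˡ (factor x)) (distribˡ _ _ _)) ⟩
    (x - a) * f x + ((a - b) * f a + (a - b) * ((x - a) * q x))
      ≈⟨ +-congˡ (+-congˡ (*-Props.x∙yz≈y∙xz _ _ _)) ⟩
    (x - a) * f x + ((a - b) * f a + (x - a) * ((a - b) * q x))
      ≈⟨ +-Props.x∙yz≈y∙xz _ _ _ ⟩
    (a - b) * f a + ((x - a) * f x + (x - a) * ((a - b) * q x))
      ≈⟨ +-congˡ (sym (distribˡ _ _ _)) ⟩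
    (a - b) * f a + (x - a) * (f x + (a - b) * q x)
      ∎

  newtonSum : (ℕ → Carrier) → (ℕ → Carrier) → ℕ → Carrier → Carrier
  newtonSum β c n x = sumTo n (λ k → c k * gfalling β x k)

  gfalling-unfoldˡ : ∀ (β : ℕ → Carrier) x k →
    gfalling β x (suc k) ≈ (x - β 0) * gfalling (β ∘ suc) x k
  gfalling-unfoldˡ β x zero    = trans (*-identityˡ _) (sym (*-identityʳ _))
  gfalling-unfoldˡ β x (suc k) = trans (*-congʳ (gfalling-unfoldˡ β x k)) (*-assoc _ _ _)

  newtonSum-unfold : ∀ n β c x →
    newtonSum β c (suc n) x ≈ c 0 + (x - β 0) * newtonSum (β ∘ suc) (c ∘ suc) n x
  newtonSum-unfold n β c x = begin
    newtonSum β c (suc n) x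
      ≈⟨ sumTo-unfoldˡ n _ ⟩
    c 0 * 1# + sumTo n (λ k → c (suc k) * gfalling β x (suc k))
      ≈⟨ +-cong (*-identityʳ _) (sumTo-cong n (λ k _ → *-congˡ (gfalling-unfoldˡ β x k))) ⟩
    c 0 + sumTo n (λ k → c (suc k) * ((x - β 0) * gfalling (β ∘ suc) x k))
      ≈⟨ +-congˡ (sumTo-cong n (λ k _ → *-Props.x∙yz≈y∙xz _ _ _)) ⟩
    c 0 + sumTo n (λ k → (x - β 0) * (c (suc k) * gfalling (β ∘ suc) x k))
      ≈⟨ +-congˡ (sumTo-*ˡ n _ _) ⟩
    c 0 + (x - β 0) * newtonSum (β ∘ suc) (c ∘ suc) n x ∎

  newtonSum-first-node : ∀ n β c → newtonSum β c (suc n) (β 0) ≈ c 0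
  newtonSum-first-node n β c = begin
    newtonSum β c (suc n) (β 0)                          ≈⟨ newtonSum-unfold n β c (β 0) ⟩
    c 0 + (β 0 - β 0) * newtonSum (β ∘ suc) (c ∘ suc) n (β 0) ≈⟨ +-congˡ (*-congʳ (-‿inverseʳ _)) ⟩
    c 0 + 0# * newtonSum (β ∘ suc) (c ∘ suc) n (β 0)     ≈⟨ +-congˡ (zeroˡ _) ⟩
    c 0 + 0#                                             ≈⟨ +-identityʳ _ ⟩
    c 0                                                  ∎

  newtonSum-poly : ∀ n β c → Poly≤ n (newtonSum β c n)
  newtonSum-poly zero    β c x y = refl
  newtonSum-poly (suc n) β c =
    poly-cong (suc n) (λ x → sym (newtonSum-unfold n β c x))
      (poly-+ (suc n) (poly-const (suc n) (c 0))
                      (poly-*-linear n (β 0) (newtonSum-poly n (β ∘ suc) (c ∘ suc))))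

  module IntegralDomain
    (no-zero-divisors : ∀ a b → a * b ≈ 0# → (a ≈ 0#) ⊎ (b ≈ 0#)) where

    *-cancelˡ-nonzero : ∀ {a u v} → a ≉ 0# → a * u ≈ a * v → u ≈ v
    *-cancelˡ-nonzero {a} {u} {v} a≉0 au≈av
      with no-zero-divisors a (u - v) (trans (x[y-z]≈xy-xz a u v) (x≈y⇒x∙y⁻¹≈ε au≈av))
    ... | inj₁ a≈0   = contradiction a≈0 a≉0
    ... | inj₂ u-v≈0 = x∙y⁻¹≈ε⇒x≈y u v u-v≈0

    *-nonzero : ∀ {a b} → a ≉ 0# → b ≉ 0# → a * b ≉ 0#
    *-nonzero {a} {b} a≉0 b≉0 ab≈0 =
      b≉0 (*-cancelˡ-nonzero a≉0 (trans ab≈0 (sym (zeroʳ a))))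

    poly-unique-on-points : ∀ n {g h : Carrier → Carrier} → Poly≤ n g → Poly≤ n h →
      (p : ℕ → Carrier) → (∀ {i j} → i < j → j ≤ n → p i ≉ p j) →
      (∀ j → j ≤ n → g (p j) ≈ h (p j)) → ∀ x → g x ≈ h x
    poly-unique-on-points zero pg ph p distinct g≈h x =
      trans (pg x (p 0)) (trans (g≈h 0 z≤n) (ph (p 0) x))
    poly-unique-on-points (suc n) {g} {h} pg ph p distinct g≈h x
      with pg (p (suc n)) | ph (p (suc n))
    ... | q , pq , g-factor | q′ , pq′ , h-factor = begin
      g x                 ≈⟨ g-factor x ⟩
      g a + (x - a) * q x  ≈⟨ +-cong ga≈ha (*-congˡ (q≈q′ x)) ⟩
      h a + (x - a) * q′ x ≈⟨ h-factor x ⟨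
      h x                 ∎
      where
      a = p (suc n)
      ga≈ha : g a ≈ h a
      ga≈ha = g≈h (suc n) ℕ.≤-refl
      q≈q′-on-points : ∀ j → j ≤ n → q (p j) ≈ q′ (p j)
      q≈q′-on-points j j≤n = *-cancelˡ-nonzero
        (λ pj-a≈0 → distinct (s≤s j≤n) ℕ.≤-refl (x∙y⁻¹≈ε⇒x≈y _ _ pj-a≈0))
        (∙-cancelˡ (g a) _ _ (begin
          g a + (p j - a) * q (p j)   ≈⟨ g-factor (p j) ⟨
          g (p j)                    ≈⟨ g≈h j (ℕ.m≤n⇒m≤1+n j≤n) ⟩
          h (p j)                    ≈⟨ h-factor (p j) ⟩
          h a + (p j - a) * q′ (p j) ≈⟨ +-congʳ ga≈ha ⟨
          g a + (p j - a) * q′ (p j) ∎))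
      q≈q′ : ∀ x → q x ≈ q′ x
      q≈q′ = poly-unique-on-points n pq pq′ p
        (λ i<j j≤n → distinct i<j (ℕ.m≤n⇒m≤1+n j≤n)) q≈q′-on-points

    module CharacteristicZero (ofℕ-suc≉0 : ∀ k → ofℕ (suc k) ≉ 0#) where

      1≉0 : 1# ≉ 0#
      1≉0 1≈0 = ofℕ-suc≉0 0 (trans (+-identityʳ 1#) 1≈0)

      pow-nonzero : ∀ {y} → y ≉ 0# → ∀ k → pow y k ≉ 0#
      pow-nonzero y≉0 zero    = 1≉0
      pow-nonzero y≉0 (suc k) = *-nonzero (pow-nonzero y≉0 k) y≉0

      ofℕ-< : ∀ {i j} → i < j → ofℕ i ≉ ofℕ j
      ofℕ-< {zero}  {suc j} _         0≈j = ofℕ-suc≉0 j (sym 0≈j)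
      ofℕ-< {suc i} {suc j} (s≤s i<j) i≈j = ofℕ-< i<j (∙-cancelˡ 1# _ _ i≈j)

      -- Characteristic zero makes the points b + 1, b + 2, … pairwise distinct and different from b.
      poly-cancel-linear : ∀ n b {g h : Carrier → Carrier} → Poly≤ n g → Poly≤ n h →
        (∀ x → (x - b) * g x ≈ (x - b) * h x) → ∀ x → g x ≈ h x
      poly-cancel-linear n b {g} {h} pg ph bg≈bh = poly-unique-on-points n pg ph p distinct g≈h
        where
        p : ℕ → Carrier
        p j = b + ofℕ (suc j)
        distinct : ∀ {i j} → i < j → j ≤ n → p i ≉ p j
        distinct i<j _ pi≈pj = ofℕ-< (s≤s i<j) (∙-cancelˡ b _ _ pi≈pj)
        pj-b≉0 : ∀ j → p j - b ≉ 0#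
        pj-b≉0 j pj-b≈0 =
          ofℕ-suc≉0 j (∙-cancelˡ b _ _ (trans (x∙y⁻¹≈ε⇒x≈y _ _ pj-b≈0) (sym (+-identityʳ b))))
        g≈h : ∀ j → j ≤ n → g (p j) ≈ h (p j)
        g≈h j _ = *-cancelˡ-nonzero (pj-b≉0 j) (bg≈bh (p j))

      newtonSum-coefficients-unique : ∀ n β (c d : ℕ → Carrier) →
        (∀ x → newtonSum β c n x ≈ newtonSum β d n x) → ∀ k → k ≤ n → c k ≈ d k
      newtonSum-coefficients-unique zero β c d c≈d zero z≤n =
        trans (sym (*-identityʳ _)) (trans (c≈d 0#) (*-identityʳ _))
      newtonSum-coefficients-unique (suc n) β c d c≈d = coefficients
        where
        c0≈d0 : c 0 ≈ d 0
        c0≈d0 = begin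
          c 0                              ≈⟨ newtonSum-first-node n β c ⟨
          newtonSum β c (suc n) (β 0)      ≈⟨ c≈d (β 0) ⟩
          newtonSum β d (suc n) (β 0)      ≈⟨ newtonSum-first-node n β d ⟩
          d 0                              ∎
        tails-agree : ∀ x →
          (x - β 0) * newtonSum (β ∘ suc) (c ∘ suc) n x ≈ (x - β 0) * newtonSum (β ∘ suc) (d ∘ suc) n x
        tails-agree x = ∙-cancelˡ (c 0) _ _ (begin
          c 0 + (x - β 0) * newtonSum (β ∘ suc) (c ∘ suc) n x ≈⟨ newtonSum-unfold n β c x ⟨
          newtonSum β c (suc n) x                          ≈⟨ c≈d x ⟩
          newtonSum β d (suc n) x                          ≈⟨ newtonSum-unfold n β d x ⟩
          d 0 + (x - β 0) * newtonSum (β ∘ suc) (d ∘ suc) n x ≈⟨ +-congʳ c0≈d0 ⟨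
          c 0 + (x - β 0) * newtonSum (β ∘ suc) (d ∘ suc) n x ∎)
        coefficients : ∀ k → k ≤ suc n → c k ≈ d k
        coefficients zero    _         = c0≈d0
        coefficients (suc k) (s≤s k≤n) =
          newtonSum-coefficients-unique n (β ∘ suc) (c ∘ suc) (d ∘ suc)
            (poly-cancel-linear n (β 0) (newtonSum-poly n _ _) (newtonSum-poly n _ _) tails-agree)
            k k≤n

mainTheorem9 : ∀ {c ℓ : Level} (R : CommutativeRing c ℓ) →
    let open CommutativeRing R
        open RingDefs R
    in (∀ (a b : Carrier) → a * b ≈ 0# → (a ≈ 0#) ⊎ (b ≈ 0#)) →
       (∀ (k : ℕ) → ¬ (ofℕ (suc k) ≈ 0#)) →
       (m r : Carrier) → ¬ (m ≈ 0#) → (α : ℕ → Carrier) →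
       (W s Wα : ℕ → ℕ → Carrier) →
       IsRWhitney2 m r W →
       IsMultiStirling1 α s →
       IsGenRWhitney2 m r α Wα →
       ∀ (n i : ℕ) → i ≤ n →
       Wα n i ≈ sumFromTo i n (λ k → pow m (k ∸ i) * W n k * s k i)
mainTheorem9 R no-zero-divisors ofℕ-suc≉0 m r m≉0 α W s Wα isW isS isWα n i i≤n =
  *-cancelˡ-nonzero (pow-nonzero m≉0 i) (begin
    pow m i * Wα n i
      ≈⟨ *-comm _ _ ⟩
    Wα n i * pow m i
      ≈⟨ newtonSum-coefficients-unique n α _ _ expansions-agree i i≤n ⟩
    sumFromTo i n (λ k → W n k * pow m k * s k i)
      ≈⟨ sumFromTo-cong i n (λ k → *-Props.xy∙z≈y∙xz (W n k) (pow m k) (s k i)) ⟩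
    sumFromTo i n (λ k → pow m k * (W n k * s k i))
      ≈⟨ sumFromTo-pow-factor i n m (λ k → W n k * s k i) ⟩
    pow m i * sumFromTo i n (λ k → pow m (k ∸ i) * (W n k * s k i))
      ≈⟨ *-congˡ (sumFromTo-cong i n (λ k → *-assoc (pow m (k ∸ i)) (W n k) (s k i))) ⟨
    pow m i * sumFromTo i n (λ k → pow m (k ∸ i) * W n k * s k i) ∎)
  where
  open CommutativeRing R
  open RingDefs R
  open NewtonExpansions R
  open IntegralDomain no-zero-divisors
  open CharacteristicZero ofℕ-suc≉0
  open import Relation.Binary.Reasoning.Setoid setoid
  expansions-agree : ∀ x → newtonSum α (λ k → Wα n k * pow m k) n x
                         ≈ newtonSum α (λ i → sumFromTo i n (λ k → W n k * pow m k * s k i)) n x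
  expansions-agree x = begin
    newtonSum α (λ k → Wα n k * pow m k) n x         ≈⟨ isWα n x ⟨
    pow (m * x + r) n                                ≈⟨ isW n x ⟩
    sumTo n (λ k → W n k * pow m k * falling x k)    ≈⟨ sumTo-change-of-basis n _ _ _ s (λ k _ → isS k x) ⟩
    newtonSum α (λ i → sumFromTo i n (λ k → W n k * pow m k * s k i)) n x ∎
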